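{- Let $p$ be a pattern. Then every ascent sequence (of every length $n$) avoiding $p$ is a restricted growth function if and only if $p$ is a subpattern of $01012$ (i.e., $01012$ contains an occurrence of $p$). In particular, if $p$ is a subpattern of $01012$ and $\mathbf{x}$ is an ascent sequence avoiding $p$, then every occurrence in $\mathbf{x}$ of each letter $k\ge1$ is preceded by some occurrence of each of the letters $0,1,\ldots,k-1$.
   Context: An ascent sequence is a finite sequence $x_1x_2\ldots x_n$ of nonnegative integers with $x_1=0$ and $x_i\le \operatorname{asc}(x_1\ldots x_{i-1})+1$ for all $1<i\le n$, where $\operatorname{asc}(y_1\ldots y_k)$ is the number of indices $j$ with $y_j<y_{j+1}$. A pattern is a finite nonempty word over the nonnegative integers. An occurrence of a pattern $p=p_1\ldots p_k$ in a sequence $x_1\ldots x_n$ is a subsequence $x_{i_1}\ldots x_{i_k}$, $i_1<\cdots<i_k$, such that for all $a,b$: $x_{i_a}<x_{i_b}$ iff $p_a<p_b$ and $x_{i_a}=x_{i_b}$ iff $p_a=p_b$. A sequence avoids $p$ if it has no occurrence of $p$. A restricted growth function (RGF) is a string of nonnegative integers starting with $0$ in which the first occurrence of each letter $k>0$ is preceded by some occurrence of $k-1$. -}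

module Defs where

open import Data.Nat using (ℕ; zero; suc; _+_; _≤_; _<_; _<?_)
open import Data.List using (List; []; _∷_; length; lookup; take)
open import Data.Fin as Fin using (Fin; toℕ)
open import Data.Product using (Σ; ∃; _×_; _,_)
open import Relation.Binary.PropositionalEquality using (_≡_; _≢_)
open import Relation.Nullary using (¬_; yes; no)
open import Function.Bundles using (_⇔_)

ascInd : ℕ → ℕ → ℕ
ascInd a b with a <? b
... | yes _ = 1
... | no  _ = 0

asc : List ℕ → ℕ
asc [] = 0
asc (a ∷ []) = 0
asc (a ∷ b ∷ t) = ascInd a b + asc (b ∷ t)

-- ascent sequence: x_1 = 0 and x_i ≤ asc(x_1 … x_{i-1}) + 1 for 1 < i ≤ n
-- (0-based index i > 0 here; take (toℕ i) x = x_1 … x_{i-1})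
IsAscent : List ℕ → Set
IsAscent x = (∃ λ t → x ≡ 0 ∷ t)
           × (∀ (i : Fin (length x)) → 0 < toℕ i →
                lookup x i ≤ suc (asc (take (toℕ i) x)))

IsPattern : List ℕ → Set
IsPattern p = p ≢ []

Occurs : List ℕ → List ℕ → Set
Occurs p x =
  Σ (Fin (length p) → Fin (length x)) λ f →
    (∀ a b → a Fin.< b → f a Fin.< f b)
    × (∀ a b → (lookup x (f a) < lookup x (f b) ⇔ lookup p a < lookup p b)
              × (lookup x (f a) ≡ lookup x (f b) ⇔ lookup p a ≡ lookup p b))

Avoids : List ℕ → List ℕ → Set
Avoids x p = ¬ Occurs p x

IsRGF : List ℕ → Set
IsRGF x = (∃ λ t → x ≡ 0 ∷ t)
        × (∀ (i : Fin (length x)) → 0 < lookup x i →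
             (∀ (j : Fin (length x)) → j Fin.< i → lookup x j ≢ lookup x i) →
             ∃ λ (j : Fin (length x)) → j Fin.< i × suc (lookup x j) ≡ lookup x i)

w01012 : List ℕ
w01012 = 0 ∷ 1 ∷ 0 ∷ 1 ∷ 2 ∷ []

module Submission where

open import Defs
open import Data.Nat using (ℕ; zero; suc; _+_; _<_; _≤_; z≤n; s≤s; s≤s⁻¹; z<s; s<s; s<s⁻¹; _<?_; _≟_)
open import Data.Nat.Properties
open import Data.List using (List; []; _∷_; length; lookup; take)
open import Data.Fin as Fin using (Fin; zero; suc; toℕ; fromℕ<; inject₁)
open import Data.Fin.Properties using (toℕ-fromℕ<; toℕ<n; all?; any?)
open import Data.Product using (∃; _×_; _,_; proj₁; proj₂)
open import Data.Sum using (_⊎_; inj₁; inj₂)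
open import Relation.Binary.PropositionalEquality using (_≡_; _≢_; refl; sym; trans; cong; subst; subst₂; module ≡-Reasoning)
open import Relation.Binary.Definitions using (tri<; tri≈; tri>)
open import Relation.Nullary using (¬_; Dec; yes; no; contradiction)
open import Relation.Nullary.Decidable using (map′; _×-dec_; _→-dec_)
open import Function using (_∘_; id)
open import Function.Bundles using (_⇔_; mk⇔; module Equivalence)
open import Function.Construct.Composition using (_⇔-∘_)
open import Function.Construct.Symmetry using (⇔-sym)

-- (⇐) If p occurs in 01012, an ascent sequence x avoiding p also avoids 01012,
-- because occurrences compose.  For such x we show by induction on prefixes
-- that x is "down-closed": every m < xᵢ already occurs before position i.
-- The invariant carried along is down-closure of the prefix together with
-- one of two witnesses bounding the next letter c:
--   * a 0101-shaped subsequence u v u v (u < v) in the prefix; then c ≤ v,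
--     since otherwise u v u v c is an occurrence of 01012;
--   * an earlier letter y ≥ asc(prefix); then c ≤ asc + 1 ≤ y + 1.
-- Either way c exceeds an earlier letter by at most one, which extends
-- down-closure, and a short case analysis re-establishes a witness.
-- Down-closure implies the RGF property.
--
-- (⇒) The ascent sequence 01013 is not an RGF, and it is an increasing
-- relabelling of 01012; so if p does not occur in 01012 it avoids p.
-- Since occurrence is decidable (a finite search) this gives the converse.

StrictlyIncreasing : (ℕ → ℕ) → Set
StrictlyIncreasing h = ∀ {a b} → a < b → h a < h b

module _ {h : ℕ → ℕ} (h-inc : StrictlyIncreasing h) where

  reflects-< : ∀ {a b} → h a < h b → a < b
  reflects-< {a} {b} ha<hb with <-cmp a b
  ... | tri< a<b _ _ = a<b
  ... | tri≈ _ refl _ = contradiction ha<hb (<-irrefl refl)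
  ... | tri> _ _ b<a = contradiction (h-inc b<a) (<-asym ha<hb)

  reflects-≡ : ∀ {a b} → h a ≡ h b → a ≡ b
  reflects-≡ {a} {b} ha≡hb with <-cmp a b
  ... | tri< a<b _ _ = contradiction ha≡hb (<⇒≢ (h-inc a<b))
  ... | tri≈ _ a≡b _ = a≡b
  ... | tri> _ _ b<a = contradiction (sym ha≡hb) (<⇒≢ (h-inc b<a))

  relabel-shape : ∀ {u v u′ v′} → u ≡ h u′ → v ≡ h v′ →
    ((u < v) ⇔ (u′ < v′)) × ((u ≡ v) ⇔ (u′ ≡ v′))
  relabel-shape refl refl = mk⇔ reflects-< h-inc , mk⇔ reflects-≡ (cong h)

-- The relabelling 0 ↦ u, 1 ↦ v, 2 + r ↦ r + w, increasing when u < v < w.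
-- It maps 01012 onto the shapes u v u v w.
relabel : ℕ → ℕ → ℕ → ℕ → ℕ
relabel u v w 0 = u
relabel u v w 1 = v
relabel u v w (suc (suc r)) = r + w

relabel-increasing : ∀ {u v w} → u < v → v < w → StrictlyIncreasing (relabel u v w)
relabel-increasing u<v v<w {0} {1} _ = u<v
relabel-increasing {w = w} u<v v<w {0} {suc (suc s)} _ =
  <-≤-trans (<-trans u<v v<w) (m≤n+m w s)
relabel-increasing {w = w} u<v v<w {1} {suc (suc s)} _ = <-≤-trans v<w (m≤n+m w s)
relabel-increasing {w = w} u<v v<w {suc (suc r)} {suc (suc s)} r+2<s+2 =
  +-monoˡ-< w (s<s⁻¹ (s<s⁻¹ r+2<s+2))
relabel-increasing u<v v<w {1} {1} (s≤s ())
relabel-increasing u<v v<w {suc (suc r)} {1} (s≤s ())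
relabel-increasing u<v v<w {_} {0} ()

IncreasingEmbedding : ∀ {k n} → (Fin k → Fin n) → Set
IncreasingEmbedding f = ∀ a b → a Fin.< b → f a Fin.< f b

IsOccurrence : (p x : List ℕ) → (Fin (length p) → Fin (length x)) → Set
IsOccurrence p x f =
  IncreasingEmbedding f
  × (∀ a b → (lookup x (f a) < lookup x (f b) ⇔ lookup p a < lookup p b)
            × (lookup x (f a) ≡ lookup x (f b) ⇔ lookup p a ≡ lookup p b))

occurs-by-relabelling : ∀ {p x} (f : Fin (length p) → Fin (length x)) (h : ℕ → ℕ) →
  IncreasingEmbedding f → StrictlyIncreasing h →
  (∀ a → lookup x (f a) ≡ h (lookup p a)) → Occurs p x
occurs-by-relabelling f h f-inc h-inc e = f , f-inc , λ a b → relabel-shape h-inc (e a) (e b)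

occurs-of-relabelling : ∀ {p x} (f : Fin (length p) → Fin (length x)) (h : ℕ → ℕ) →
  IncreasingEmbedding f → StrictlyIncreasing h →
  (∀ a → lookup p a ≡ h (lookup x (f a))) → Occurs p x
occurs-of-relabelling f h f-inc h-inc e = f , f-inc , λ a b →
  let (<-shape , ≡-shape) = relabel-shape h-inc (e a) (e b) in ⇔-sym <-shape , ⇔-sym ≡-shape

occurs-trans : (p w x : List ℕ) → Occurs p w → Occurs w x → Occurs p x
occurs-trans _ _ _ (f , f-inc , f-shape) (g , g-inc , g-shape) =
  g ∘ f , (λ a b a<b → g-inc (f a) (f b) (f-inc a b a<b)) , λ a b →
  proj₁ (f-shape a b) ⇔-∘ proj₁ (g-shape (f a) (f b)) ,
  proj₂ (f-shape a b) ⇔-∘ proj₂ (g-shape (f a) (f b))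

-- Occurrence is decidable.  Without function extensionality, a property of
-- maps Fin k → Fin n can be decided by exhaustive search as long as it is
-- invariant under pointwise equality.

module Decide where

  open Equivalence using (to; from)

  extend : ∀ {k n} → Fin n → (Fin k → Fin n) → Fin (suc k) → Fin n
  extend a g zero = a
  extend a g (suc i) = g i

  Pointwise-invariant : ∀ {k n} → ((Fin k → Fin n) → Set) → Set
  Pointwise-invariant P = ∀ {f g} → (∀ i → f i ≡ g i) → P f → P g

  search : ∀ k n (P : (Fin k → Fin n) → Set) →
    Pointwise-invariant P → (∀ f → Dec (P f)) → Dec (∃ P)
  search zero n P resp P? with P? (λ ())
  ... | yes Pf = yes ((λ ()) , Pf)
  ... | no ¬Pf = no λ (f , Pf) → ¬Pf (resp (λ ()) Pf)
  search (suc k) n P resp P?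
    with any? (λ a → search k n (P ∘ extend a) (λ e → resp λ { zero → refl ; (suc i) → e i })
                                  (P? ∘ extend a))
  ... | yes (a , g , Pag) = yes (extend a g , Pag)
  ... | no ¬∃ = no λ (f , Pf) →
    ¬∃ (f zero , f ∘ suc , resp (λ { zero → refl ; (suc i) → refl }) Pf)

  _⇔?_ : ∀ {A B : Set} → Dec A → Dec B → Dec (A ⇔ B)
  A? ⇔? B? = map′ (λ (ab , ba) → mk⇔ ab ba) (λ e → to e , from e)
                  ((A? →-dec B?) ×-dec (B? →-dec A?))

  occurs? : (p x : List ℕ) → Dec (Occurs p x)
  occurs? p x = search (length p) (length x) (IsOccurrence p x) resp P?
    where
    resp : Pointwise-invariant (IsOccurrence p x)
    resp e (f-inc , f-shape) =
      (λ a b a<b → subst₂ Fin._<_ (e a) (e b) (f-inc a b a<b)) , λ a b →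
      subst₂ (λ u v → ((lookup x u < lookup x v) ⇔ (lookup p a < lookup p b))
                     × ((lookup x u ≡ lookup x v) ⇔ (lookup p a ≡ lookup p b)))
             (e a) (e b) (f-shape a b)
    P? : ∀ f → Dec (IsOccurrence p x f)
    P? f = all? (λ a → all? λ b → (a Fin.<? b) →-dec (f a Fin.<? f b)) ×-dec
           all? (λ a → all? λ b →
             ((lookup x (f a) <? lookup x (f b)) ⇔? (lookup p a <? lookup p b)) ×-dec
             ((lookup x (f a) ≟ lookup x (f b)) ⇔? (lookup p a ≟ lookup p b)))

-- Positions as natural numbers.  `at x k` is the k-th letter of x (0 past the end).

at : List ℕ → ℕ → ℕ
at [] _ = 0
at (a ∷ _) zero = a
at (_ ∷ t) (suc k) = at t k

lookup-at : (x : List ℕ) (i : Fin (length x)) → lookup x i ≡ at x (toℕ i)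
lookup-at (a ∷ t) zero = refl
lookup-at (a ∷ t) (suc i) = lookup-at t i

lookup-fromℕ< : (x : List ℕ) {k : ℕ} (k<n : k < length x) → lookup x (fromℕ< k<n) ≡ at x k
lookup-fromℕ< x k<n = trans (lookup-at x (fromℕ< k<n)) (cong (at x) (toℕ-fromℕ< k<n))

chain-increasing : ∀ {k} (g : Fin (suc k) → ℕ) → (∀ j → g (inject₁ j) < g (suc j)) →
  ∀ a b → a Fin.< b → g a < g b
chain-increasing g step zero (suc zero) _ = step zero
chain-increasing {suc k} g step zero (suc (suc b)) _ =
  <-trans (step zero) (chain-increasing (g ∘ suc) (step ∘ suc) zero (suc b) z<s)
chain-increasing {suc k} g step (suc a) (suc b) a<b =
  chain-increasing (g ∘ suc) (step ∘ suc) a b (s<s⁻¹ a<b)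

occurs-01012 : (x : List ℕ) {i₀ i₁ i₂ i₃ i₄ : ℕ} →
  i₀ < i₁ → i₁ < i₂ → i₂ < i₃ → i₃ < i₄ → i₄ < length x →
  at x i₀ ≡ at x i₂ → at x i₁ ≡ at x i₃ → at x i₀ < at x i₁ → at x i₁ < at x i₄ →
  Occurs w01012 x
occurs-01012 x {i₀} {i₁} {i₂} {i₃} {i₄} i₀<i₁ i₁<i₂ i₂<i₃ i₃<i₄ i₄<n e₀₂ e₁₃ u<v v<w =
  occurs-by-relabelling {x = x} pos (relabel (at x i₀) (at x i₁) (at x i₄)) pos-inc
    (relabel-increasing u<v v<w) letters
  where
  i₀<n : i₀ < length x
  i₁<n : i₁ < length x
  i₂<n : i₂ < length x
  i₃<n : i₃ < length x
  i₃<n = <-trans i₃<i₄ i₄<n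
  i₂<n = <-trans i₂<i₃ i₃<n
  i₁<n = <-trans i₁<i₂ i₂<n
  i₀<n = <-trans i₀<i₁ i₁<n

  pos : Fin 5 → Fin (length x)
  pos zero = fromℕ< i₀<n
  pos (suc zero) = fromℕ< i₁<n
  pos (suc (suc zero)) = fromℕ< i₂<n
  pos (suc (suc (suc zero))) = fromℕ< i₃<n
  pos (suc (suc (suc (suc zero)))) = fromℕ< i₄<n

  fromℕ<-mono : ∀ {a b} (a<n : a < length x) (b<n : b < length x) → a < b →
    fromℕ< a<n Fin.< fromℕ< b<n
  fromℕ<-mono a<n b<n = subst₂ _<_ (sym (toℕ-fromℕ< a<n)) (sym (toℕ-fromℕ< b<n))

  pos-inc : IncreasingEmbedding pos
  pos-inc = chain-increasing (toℕ ∘ pos) λ where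
    zero → fromℕ<-mono i₀<n i₁<n i₀<i₁
    (suc zero) → fromℕ<-mono i₁<n i₂<n i₁<i₂
    (suc (suc zero)) → fromℕ<-mono i₂<n i₃<n i₂<i₃
    (suc (suc (suc zero))) → fromℕ<-mono i₃<n i₄<n i₃<i₄

  letters : ∀ a → lookup x (pos a) ≡ relabel (at x i₀) (at x i₁) (at x i₄) (lookup w01012 a)
  letters zero = lookup-fromℕ< x i₀<n
  letters (suc zero) = lookup-fromℕ< x i₁<n
  letters (suc (suc zero)) = trans (lookup-fromℕ< x i₂<n) (sym e₀₂)
  letters (suc (suc (suc zero))) = trans (lookup-fromℕ< x i₃<n) (sym e₁₃)
  letters (suc (suc (suc (suc zero)))) = lookup-fromℕ< x i₄<n

ascInd-≤1 : ∀ a b → ascInd a b ≤ 1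
ascInd-≤1 a b with a <? b
... | yes _ = ≤-refl
... | no _ = z≤n

ascInd-≮ : ∀ {a b} → ¬ a < b → ascInd a b ≡ 0
ascInd-≮ {a} {b} a≮b with a <? b
... | yes a<b = contradiction a<b a≮b
... | no _ = refl

asc-take-1 : ∀ x → asc (take 1 x) ≡ 0
asc-take-1 [] = refl
asc-take-1 (a ∷ t) = refl

asc-snoc : ∀ (x : List ℕ) k → suc k < length x →
  asc (take (suc (suc k)) x) ≡ asc (take (suc k) x) + ascInd (at x k) (at x (suc k))
asc-snoc (a ∷ b ∷ t) zero _ = +-identityʳ (ascInd a b)
asc-snoc (a ∷ b ∷ t) (suc k) k+2<n = begin
  ascInd a b + asc (take (suc (suc k)) (b ∷ t))
    ≡⟨ cong (ascInd a b +_) (asc-snoc (b ∷ t) k (s<s⁻¹ k+2<n)) ⟩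
  ascInd a b + (asc (take (suc k) (b ∷ t)) + ascInd (at (b ∷ t) k) (at (b ∷ t) (suc k)))
    ≡⟨ +-assoc (ascInd a b) _ _ ⟨
  ascInd a b + asc (take (suc k) (b ∷ t)) + ascInd (at (b ∷ t) k) (at (b ∷ t) (suc k)) ∎
  where open ≡-Reasoning
asc-snoc (a ∷ []) k (s≤s ())

asc-snoc-no-ascent : ∀ (x : List ℕ) k → suc k < length x → ¬ at x k < at x (suc k) →
  asc (take (suc (suc k)) x) ≡ asc (take (suc k) x)
asc-snoc-no-ascent x k k+1<n no-ascent = begin
  asc (take (suc (suc k)) x)                            ≡⟨ asc-snoc x k k+1<n ⟩
  asc (take (suc k) x) + ascInd (at x k) (at x (suc k))
    ≡⟨ cong (asc (take (suc k) x) +_) (ascInd-≮ no-ascent) ⟩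
  asc (take (suc k) x) + 0                              ≡⟨ +-identityʳ _ ⟩
  asc (take (suc k) x)                                  ∎
  where open ≡-Reasoning

ascent-growth : ∀ {x} → IsAscent x →
  ∀ k → k < length x → 0 < k → at x k ≤ suc (asc (take k x))
ascent-growth {x} (_ , growth) k k<n 0<k =
  subst₂ (λ c j → c ≤ suc (asc (take j x))) (lookup-fromℕ< x k<n) (toℕ-fromℕ< k<n)
    (growth (fromℕ< k<n) (subst (0 <_) (sym (toℕ-fromℕ< k<n)) 0<k))

module AvoidingAscent (x : List ℕ) (x₀≡0 : at x 0 ≡ 0)
  (growth : ∀ k → k < length x → 0 < k → at x k ≤ suc (asc (take k x)))
  (avoid : ¬ Occurs w01012 x) where

  Seen : ℕ → ℕ → Set
  Seen k m = ∃ λ j → j < k × at x j ≡ m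

  DownClosed : ℕ → Set
  DownClosed k = ∀ i → i < k → ∀ m → m < at x i → Seen i m

  record Has0101 (k : ℕ) : Set where
    field
      {i₀ i₁ i₂ i₃} : ℕ
      i₀<i₁ : i₀ < i₁
      i₁<i₂ : i₁ < i₂
      i₂<i₃ : i₂ < i₃
      i₃<k : i₃ < k
      low : at x i₀ ≡ at x i₂
      high : at x i₁ ≡ at x i₃
      low<high : at x i₀ < at x i₁

  Tall : ℕ → Set
  Tall k = ∃ λ i → i < k × asc (take k x) ≤ at x i

  seen-weaken : ∀ {j k m} → j ≤ k → Seen j m → Seen k m
  seen-weaken j≤k (i , i<j , e) = i , <-≤-trans i<j j≤k , e

  seen-upto : ∀ {k i m} → DownClosed k → i < k → m ≤ at x i → Seen k m
  seen-upto {i = i} dc i<k m≤xᵢ with m≤n⇒m<n∨m≡n m≤xᵢ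
  ... | inj₁ m<xᵢ = seen-weaken (<⇒≤ i<k) (dc i i<k _ m<xᵢ)
  ... | inj₂ refl = i , i<k , refl

  down-closed-extend : ∀ {k i} → DownClosed k → i < k → at x k ≤ suc (at x i) →
    DownClosed (suc k)
  down-closed-extend {k} dc i<k bound j j<k+1 with m<1+n⇒m<n∨m≡n j<k+1
  ... | inj₁ j<k = dc j j<k
  ... | inj₂ refl = λ m m<xₖ → seen-upto dc i<k (s≤s⁻¹ (<-≤-trans m<xₖ bound))

  has0101-weaken : ∀ {k} → Has0101 k → Has0101 (suc k)
  has0101-weaken o = record
    { i₀<i₁ = i₀<i₁ ; i₁<i₂ = i₁<i₂ ; i₂<i₃ = i₂<i₃ ; i₃<k = m<n⇒m<1+n i₃<k
    ; low = low ; high = high ; low<high = low<high }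
    where open Has0101 o

  -- After a 0101 shape u v u v, no letter exceeds v: it would complete 01012.
  capped : ∀ {k} → (o : Has0101 k) → k < length x → at x k ≤ at x (Has0101.i₁ o)
  capped o k<n = ≮⇒≥ λ v<c →
    avoid (occurs-01012 x i₀<i₁ i₁<i₂ i₂<i₃ i₃<k k<n low high low<high v<c)
    where open Has0101 o

  new-0101 : ∀ {k} → DownClosed (suc k) → Seen (suc k) (at x (suc k)) →
    at x k < at x (suc k) → Has0101 (suc (suc k))
  new-0101 {k} dc (i₁ , i₁<k+1 , x₁≡c) d<c with m<1+n⇒m<n∨m≡n i₁<k+1
  ... | inj₂ refl = contradiction x₁≡c (<⇒≢ d<c)
  ... | inj₁ i₁<k with dc i₁ i₁<k+1 (at x k) (subst (at x k <_) (sym x₁≡c) d<c)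
  ...   | i₀ , i₀<i₁ , x₀≡d = record
    { i₀<i₁ = i₀<i₁ ; i₁<i₂ = i₁<k ; i₂<i₃ = n<1+n k ; i₃<k = n<1+n (suc k)
    ; low = x₀≡d ; high = x₁≡c ; low<high = subst₂ _<_ (sym x₀≡d) (sym x₁≡c) d<c }

  -- Starting from a tall letter y ≥ asc, the next letter c is at most y + 1
  -- by the growth condition.  If c = y + 1 then c itself is tall; otherwise
  -- c ≤ y has been seen, and either c ends an ascent (creating a 0101 shape)
  -- or the ascent count is unchanged and y stays tall.
  tall-step : ∀ {k} → suc k < length x → DownClosed (suc k) → Tall (suc k) →
    ∃ λ i → i < suc k × at x (suc k) ≤ suc (at x i)
          × (Has0101 (suc (suc k)) ⊎ Tall (suc (suc k)))
  tall-step {k} k+1<n dc (i , i<k+1 , asc≤y) with at x i <? at x (suc k)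
  ... | yes y<c = i , i<k+1 , c≤y+1 , inj₂ (suc k , n<1+n (suc k) , asc≤c)
    where
    c≤y+1 : at x (suc k) ≤ suc (at x i)
    c≤y+1 = ≤-trans (growth (suc k) k+1<n z<s) (s≤s asc≤y)
    asc≤c : asc (take (suc (suc k)) x) ≤ at x (suc k)
    asc≤c = begin
      asc (take (suc (suc k)) x)                            ≡⟨ asc-snoc x k k+1<n ⟩
      asc (take (suc k) x) + ascInd (at x k) (at x (suc k)) ≤⟨ +-mono-≤ asc≤y (ascInd-≤1 _ _) ⟩
      at x i + 1                                            ≡⟨ +-comm (at x i) 1 ⟩
      suc (at x i)                                          ≤⟨ y<c ⟩
      at x (suc k)                                          ∎
      where open ≤-Reasoning
  ... | no y≮c with at x k <? at x (suc k)
  ...   | yes d<c = i , i<k+1 , m≤n⇒m≤1+n (≮⇒≥ y≮c) ,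
                    inj₁ (new-0101 dc (seen-upto dc i<k+1 (≮⇒≥ y≮c)) d<c)
  ...   | no d≮c = i , i<k+1 , m≤n⇒m≤1+n (≮⇒≥ y≮c) ,
                   inj₂ (i , m<n⇒m<1+n i<k+1 ,
                         ≤-trans (≤-reflexive (asc-snoc-no-ascent x k k+1<n d≮c)) asc≤y)

  Invariant : ℕ → Set
  Invariant k = DownClosed k × (Has0101 k ⊎ Tall k)

  initial : Invariant 1
  initial = down-closed-1 , inj₂ (0 , z<s , subst (_≤ at x 0) (sym (asc-take-1 x)) z≤n)
    where
    down-closed-1 : DownClosed 1
    down-closed-1 zero _ m m<x₀ = contradiction (subst (m <_) x₀≡0 m<x₀) n≮0
    down-closed-1 (suc i) (s≤s ())

  step : ∀ {k} → suc k < length x → Invariant (suc k) → Invariant (suc (suc k))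
  step {k} k+1<n (dc , inj₁ o) =
    down-closed-extend dc i₁<k+1 (m≤n⇒m≤1+n (capped o k+1<n)) , inj₁ (has0101-weaken o)
    where
    open Has0101 o
    i₁<k+1 : i₁ < suc k
    i₁<k+1 = <-trans i₁<i₂ (<-trans i₂<i₃ i₃<k)
  step k+1<n (dc , inj₂ tall) with tall-step k+1<n dc tall
  ... | i , i<k+1 , bound , witness = down-closed-extend dc i<k+1 bound , witness

  invariant : ∀ k → k < length x → Invariant (suc k)
  invariant zero _ = initial
  invariant (suc k) k+1<n = step k+1<n (invariant k (<-trans (n<1+n k) k+1<n))

  down-closed : DownClosed (length x)
  down-closed i i<n = proj₁ (invariant i i<n) i (n<1+n i)

avoiding-01012-down-closed : (x : List ℕ) → IsAscent x → Avoids x w01012 →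
  ∀ (i : Fin (length x)) (m : ℕ) → m < lookup x i →
  ∃ λ (j : Fin (length x)) → j Fin.< i × lookup x j ≡ m
avoiding-01012-down-closed x ascent@((_ , refl) , _) avoid i m m<xᵢ
  with AvoidingAscent.down-closed x refl (ascent-growth ascent) avoid
         (toℕ i) (toℕ<n i) m (subst (m <_) (lookup-at x i) m<xᵢ)
... | j , j<i , xⱼ≡m =
  fromℕ< j<n , subst (_< toℕ i) (sym (toℕ-fromℕ< j<n)) j<i , trans (lookup-fromℕ< x j<n) xⱼ≡m
  where
  j<n : j < length x
  j<n = <-trans j<i (toℕ<n i)

down-closed⇒RGF : ∀ {x} → (∃ λ t → x ≡ 0 ∷ t) →
  (∀ (i : Fin (length x)) m → m < lookup x i → ∃ λ j → j Fin.< i × lookup x j ≡ m) →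
  IsRGF x
down-closed⇒RGF {x} starts-0 preceded = starts-0 , λ i 0<xᵢ _ → predecessor i 0<xᵢ
  where
  predecessor : ∀ i → 0 < lookup x i → ∃ λ j → j Fin.< i × suc (lookup x j) ≡ lookup x i
  predecessor i 0<xᵢ with lookup x i | preceded i
  ... | suc c | below = let (j , j<i , xⱼ≡c) = below c ≤-refl in j , j<i , cong suc xⱼ≡c

y01013 : List ℕ
y01013 = 0 ∷ 1 ∷ 0 ∷ 1 ∷ 3 ∷ []

y01013-ascent : IsAscent y01013
y01013-ascent = (_ , refl) , growth
  where
  growth : ∀ (i : Fin 5) → 0 < toℕ i → lookup y01013 i ≤ suc (asc (take (toℕ i) y01013))
  growth (suc zero) _ = s≤s z≤n
  growth (suc (suc zero)) _ = z≤n
  growth (suc (suc (suc zero))) _ = s≤s z≤n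
  growth (suc (suc (suc (suc zero)))) _ = ≤-refl

-- The letter 3 at position 4 occurs first there, but 2 never occurs.
y01013-not-RGF : ¬ IsRGF y01013
y01013-not-RGF (_ , rgf) with rgf four z<s first-3
  where
  four : Fin 5
  four = suc (suc (suc (suc zero)))
  first-3 : ∀ j → j Fin.< four → lookup y01013 j ≢ 3
  first-3 zero _ ()
  first-3 (suc zero) _ ()
  first-3 (suc (suc zero)) _ ()
  first-3 (suc (suc (suc zero))) _ ()
  first-3 (suc (suc (suc (suc zero)))) 4<4 = contradiction 4<4 (<-irrefl refl)
... | zero , _ , ()
... | suc zero , _ , ()
... | suc (suc zero) , _ , ()
... | suc (suc (suc zero)) , _ , ()
... | suc (suc (suc (suc zero))) , 4<4 , _ = contradiction 4<4 (<-irrefl refl)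

-- 01013 is the relabelling 0 ↦ 0, 1 ↦ 1, 2 ↦ 3 of 01012.
y01013-in-01012 : Occurs y01013 w01012
y01013-in-01012 =
  occurs-of-relabelling {y01013} {w01012} id (relabel 0 1 3) (λ _ _ a<b → a<b)
    (relabel-increasing z<s (s<s z<s))
    λ where
      zero → refl
      (suc zero) → refl
      (suc (suc zero)) → refl
      (suc (suc (suc zero))) → refl
      (suc (suc (suc (suc zero)))) → refl

lemma2p4 : (p : List ℕ) → IsPattern p →
    (((x : List ℕ) → IsAscent x → Avoids x p → IsRGF x) ⇔ Occurs p w01012)
    × (Occurs p w01012 → (x : List ℕ) → IsAscent x → Avoids x p →
    ∀ (i : Fin (length x)) (m : ℕ) → m < lookup x i →
    ∃ λ (j : Fin (length x)) → j Fin.< i × lookup x j ≡ m)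
lemma2p4 p _ = mk⇔ only-subpatterns subpatterns-force-RGF , down-closure
  where
  -- avoiding a subpattern of 01012 entails avoiding 01012
  down-closure : Occurs p w01012 → (x : List ℕ) → IsAscent x → Avoids x p →
    ∀ (i : Fin (length x)) (m : ℕ) → m < lookup x i →
    ∃ λ (j : Fin (length x)) → j Fin.< i × lookup x j ≡ m
  down-closure p≤w x ascent avoid =
    avoiding-01012-down-closed x ascent (avoid ∘ occurs-trans p w01012 x p≤w)

  subpatterns-force-RGF : Occurs p w01012 →
    (x : List ℕ) → IsAscent x → Avoids x p → IsRGF x
  subpatterns-force-RGF p≤w x ascent avoid =
    down-closed⇒RGF (proj₁ ascent) (down-closure p≤w x ascent avoid)

  -- if p does not occur in 01012, then 01013 is a non-RGF ascent sequence avoiding p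
  only-subpatterns : ((x : List ℕ) → IsAscent x → Avoids x p → IsRGF x) → Occurs p w01012
  only-subpatterns forces-RGF with Decide.occurs? p w01012
  ... | yes p≤w = p≤w
  ... | no p≰w = contradiction
    (forces-RGF y01013 y01013-ascent
      λ p≤y → p≰w (occurs-trans p y01013 w01012 p≤y y01013-in-01012))
    y01013-not-RGF
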